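{- Let $x=p_1^{\alpha_1}p_2^{\alpha_2}\cdots p_r^{\alpha_r}$, where $\alpha_1,\ldots,\alpha_r$ are positive integers and $p_1,\ldots,p_r$ are distinct prime numbers. If $y=p_1^{\beta_1}p_2^{\beta_2}\cdots p_r^{\beta_r}$ with $0\leq\beta_i\leq\alpha_i$ for $1\leq i\leq r$, then $$\sum_{d\mid y}\phi\!\left(\frac{x}{d}\right)=\left(\prod_{\substack{1\leq i\leq r\\ \alpha_i=\beta_i}}p_i^{\alpha_i}\right)\left(\prod_{\substack{1\leq i\leq r\\ \alpha_i>\beta_i}}\left(p_i^{\alpha_i}-p_i^{\alpha_i-\beta_i-1}\right)\right),$$ where the sum is over positive divisors $d$ of $y$.
   Context: $\phi$ denotes Euler's totient function. -}

module Defs where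

open import Data.Nat using (ℕ; zero; suc; _+_; _*_; _≟_)
open import Data.Nat.GCD using (gcd)
open import Data.Nat.Divisibility using (_∣?_)
open import Data.Nat.DivMod using (_/_)
open import Data.List using (List; length; filter; map; upTo)
open import Data.Nat.ListAction using (sum)
open import Data.Fin using (Fin; zero; suc)
open import Relation.Unary using (Decidable)

oneTo : ℕ → List ℕ
oneTo n = map suc (upTo n)

φ : ℕ → ℕ
φ n = length (filter (λ k → gcd k n ≟ 1) (oneTo n))

-- ∑_{d ∣ y} φ (x / d), d = suc k ranging over 1..y with d ∣ y
sumφQuot : ℕ → ℕ → ℕ
sumφQuot x y = sum (map g (filter (λ k → suc k ∣? y) (upTo y)))
  where
  g : ℕ → ℕ
  g k = φ (x / suc k)

∏ : (r : ℕ) → (Fin r → ℕ) → ℕ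
∏ zero    f = 1
∏ (suc r) f = f zero * ∏ r (λ i → f (suc i))

module Submission where

-- Write  count x y  for the number of residues k < x with
-- gcd k x ∣ y.  Grouping the residues k < x by d = gcd k x, and using that
-- φ (x / d) counts the k < x with gcd k x = d, the divisor sum becomes
--     ∑_{d ∣ y} φ (x / d) = count x y        (for y ∣ x, x ≠ 0).
-- The count factors over the primes: if p ∤ X, p ∤ Y and b ≤ a, then
--     count (p^a X) (p^b Y) = localFactor p a b * count X Y,
-- because  gcd k (p^a X) ∣ p^b Y  splits into the independent tests
-- gcd k X ∣ Y (which is X-periodic in k) and gcd k (p^a) ∣ p^b.  The latter
-- always holds when b = a (factor p^a); for b < a it fails exactly on the
-- multiples of p^(b+1), which a sieve removes (factor p^a − p^(a−b−1)).
-- Induction over the primes then yields the closed form.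

open import Defs
open import Level using (0ℓ)
open import Data.Nat using (ℕ; zero; suc; _+_; _*_; _^_; _∸_; _≤_; _<_; _≟_; _<?_; _≤?_;
  z≤n; s≤s; NonZero; ≢-nonZero; ≢-nonZero⁻¹; nonTrivial⇒≢1)
open import Data.Nat.Properties
open import Data.Nat.Divisibility
open import Data.Nat.DivMod using (_/_; m*n/n≡m)
open import Data.Nat.GCD
open import Data.Nat.Coprimality using (Coprime; coprime-divisor) renaming (sym to coprime-sym)
open import Data.Nat.Primality using (Prime; prime⇒irreducible; prime⇒nonZero; prime⇒nonTrivial; euclidsLemma)
open import Data.Nat.ListAction using (sum)
open import Data.List using (length; filter; map; upTo; applyUpTo)
open import Data.List.Properties using (map-upTo)
open import Data.Fin using (Fin) renaming (zero to fzero; suc to fsuc)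
open import Data.Fin.Properties using () renaming (0≢1+n to fzero≢fsuc; suc-injective to fsuc-injective)
open import Data.Product using (_×_; _,_; ∃-syntax)
open import Data.Sum using (inj₁; inj₂)
open import Data.Bool using (if_then_else_)
open import Data.Empty using (⊥-elim)
open import Relation.Nullary using (Dec; yes; no; ¬_; ¬?)
open import Relation.Nullary.Decidable using (⌊_⌋; _×-dec_)
open import Relation.Unary using (Pred; Decidable)
open import Relation.Binary.PropositionalEquality
open import Function.Definitions using (Injective)
open import Algebra.Properties.CommutativeSemigroup +-commutativeSemigroup
  using () renaming (interchange to +-interchange)
open import Algebra.Properties.CommutativeSemigroup *-commutativeSemigroup
  using () renaming (interchange to *-interchange)
open ≡-Reasoning

-- Indicators and finite sums

χ : {P : Set} → Dec P → ℕ
χ (yes _) = 1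
χ (no _)  = 0

χ-yes : {P : Set} → P → (d : Dec P) → χ d ≡ 1
χ-yes _ (yes _) = refl
χ-yes p (no ¬p) = ⊥-elim (¬p p)

χ-no : {P : Set} → ¬ P → (d : Dec P) → χ d ≡ 0
χ-no ¬p (yes p) = ⊥-elim (¬p p)
χ-no _  (no _)  = refl

χ-cong : {P Q : Set} → (P → Q) → (Q → P) → (d : Dec P) (e : Dec Q) → χ d ≡ χ e
χ-cong f g (yes p) e = sym (χ-yes (f p) e)
χ-cong f g (no ¬p) e = sym (χ-no (λ q → ¬p (g q)) e)

χ-× : {P Q : Set} (d : Dec P) (e : Dec Q) → χ (d ×-dec e) ≡ χ d * χ e
χ-× (yes _) (yes _) = refl
χ-× (yes _) (no _)  = refl
χ-× (no _)  (yes _) = refl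
χ-× (no _)  (no _)  = refl

χ-¬ : {P : Set} (d : Dec P) → χ d + χ (¬? d) ≡ 1
χ-¬ (yes _) = refl
χ-¬ (no _)  = refl

∑ : ℕ → (ℕ → ℕ) → ℕ
∑ zero    f = 0
∑ (suc n) f = f 0 + ∑ n (λ k → f (suc k))

∑-cong : ∀ n {f g : ℕ → ℕ} → (∀ k → f k ≡ g k) → ∑ n f ≡ ∑ n g
∑-cong zero    f≗g = refl
∑-cong (suc n) f≗g = cong₂ _+_ (f≗g 0) (∑-cong n (λ k → f≗g (suc k)))

∑-zero : ∀ n {f : ℕ → ℕ} → (∀ k → k < n → f k ≡ 0) → ∑ n f ≡ 0
∑-zero zero    f≡0 = refl
∑-zero (suc n) f≡0 = cong₂ _+_ (f≡0 0 (s≤s z≤n)) (∑-zero n (λ k k<n → f≡0 (suc k) (s≤s k<n)))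

∑-+ : ∀ n (f g : ℕ → ℕ) → ∑ n (λ k → f k + g k) ≡ ∑ n f + ∑ n g
∑-+ zero    f g = refl
∑-+ (suc n) f g = trans (cong (f 0 + g 0 +_) (∑-+ n (λ k → f (suc k)) (λ k → g (suc k))))
                        (+-interchange (f 0) (g 0) _ _)

∑-*ˡ : ∀ n c (f : ℕ → ℕ) → c * ∑ n f ≡ ∑ n (λ k → c * f k)
∑-*ˡ zero    c f = *-zeroʳ c
∑-*ˡ (suc n) c f = trans (*-distribˡ-+ c (f 0) _) (cong (c * f 0 +_) (∑-*ˡ n c (λ k → f (suc k))))

∑-const : ∀ n c → ∑ n (λ _ → c) ≡ n * c
∑-const zero    c = refl
∑-const (suc n) c = cong (c +_) (∑-const n c)

∑-swap : ∀ m n (f : ℕ → ℕ → ℕ) → ∑ m (λ i → ∑ n (f i)) ≡ ∑ n (λ j → ∑ m (λ i → f i j))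
∑-swap zero    n f = sym (∑-zero n (λ _ _ → refl))
∑-swap (suc m) n f = trans (cong (∑ n (f 0) +_) (∑-swap m n (λ i → f (suc i))))
                           (sym (∑-+ n (f 0) (λ j → ∑ m (λ i → f (suc i) j))))

∑-++ : ∀ m n (f : ℕ → ℕ) → ∑ (m + n) f ≡ ∑ m f + ∑ n (λ k → f (m + k))
∑-++ zero    n f = refl
∑-++ (suc m) n f = trans (cong (f 0 +_) (∑-++ m n (λ k → f (suc k)))) (sym (+-assoc (f 0) _ _))

∑-blocks : ∀ m d (f : ℕ → ℕ) → ∑ (m * d) f ≡ ∑ m (λ j → ∑ d (λ i → f (j * d + i)))
∑-blocks zero    d f = refl
∑-blocks (suc m) d f = begin
  ∑ (d + m * d) f                                       ≡⟨ ∑-++ d (m * d) f ⟩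
  ∑ d f + ∑ (m * d) (λ k → f (d + k))                   ≡⟨ cong (∑ d f +_) (∑-blocks m d (λ k → f (d + k))) ⟩
  ∑ d f + ∑ m (λ j → ∑ d (λ i → f (d + (j * d + i))))  ≡⟨ cong (∑ d f +_) (∑-cong m (λ j → ∑-cong d (λ i →
                                                            cong f (sym (+-assoc d (j * d) i))))) ⟩
  ∑ d f + ∑ m (λ j → ∑ d (λ i → f (suc j * d + i)))    ∎

∑-periodic : ∀ m d (f : ℕ → ℕ) → (∀ j i → f (j * d + i) ≡ f i) → ∑ (m * d) f ≡ m * ∑ d f
∑-periodic m d f periodic = begin
  ∑ (m * d) f                                ≡⟨ ∑-blocks m d f ⟩
  ∑ m (λ j → ∑ d (λ i → f (j * d + i)))      ≡⟨ ∑-cong m (λ j → ∑-cong d (periodic j)) ⟩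
  ∑ m (λ _ → ∑ d f)                          ≡⟨ ∑-const m (∑ d f) ⟩
  m * ∑ d f                                  ∎

∑-snoc : ∀ n (f : ℕ → ℕ) → ∑ (suc n) f ≡ ∑ n f + f n
∑-snoc zero    f = +-identityʳ (f 0)
∑-snoc (suc n) f = trans (cong (f 0 +_) (∑-snoc n (λ k → f (suc k)))) (sym (+-assoc (f 0) _ _))

∑-rotate : ∀ n (f : ℕ → ℕ) → f n ≡ f 0 → ∑ n (λ k → f (suc k)) ≡ ∑ n f
∑-rotate n f fn≡f0 = +-cancelʳ-≡ _ _ _ (begin
  ∑ n (λ k → f (suc k)) + f 0  ≡⟨ +-comm _ (f 0) ⟩
  ∑ (suc n) f                  ≡⟨ ∑-snoc n f ⟩
  ∑ n f + f n                  ≡⟨ cong (∑ n f +_) fn≡f0 ⟩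
  ∑ n f + f 0                  ∎)

∑-multiples : ∀ m d .{{_ : NonZero d}} (h : ℕ → ℕ) →
  ∑ (m * d) (λ k → χ (d ∣? k) * h k) ≡ ∑ m (λ j → h (j * d))
∑-multiples m d@(suc d′) h = trans (∑-blocks m d _) (∑-cong m block)
  where
  -- in the block starting at j * d only the first residue is a multiple of d
  block : ∀ j → ∑ d (λ i → χ (d ∣? (j * d + i)) * h (j * d + i)) ≡ h (j * d)
  block j = begin
    χ (d ∣? (j * d + 0)) * h (j * d + 0) + ∑ d′ (λ i → χ (d ∣? (j * d + suc i)) * h (j * d + suc i))
      ≡⟨ cong₂ _+_ (cong (_* h (j * d + 0)) (χ-yes (∣m∣n⇒∣m+n (n∣m*n j) (d ∣0)) (d ∣? _)))
                   (∑-zero d′ (λ i i<d′ → cong (_* h (j * d + suc i))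
                     (χ-no (λ d∣ → <⇒≱ (s≤s i<d′) (∣⇒≤ (∣m+n∣m⇒∣n d∣ (n∣m*n j)))) (d ∣? _)))) ⟩
    1 * h (j * d + 0) + 0  ≡⟨ +-identityʳ _ ⟩
    1 * h (j * d + 0)      ≡⟨ *-identityˡ _ ⟩
    h (j * d + 0)          ≡⟨ cong h (+-identityʳ (j * d)) ⟩
    h (j * d)              ∎

∑-nonMultiples : ∀ m d .{{_ : NonZero d}} (h : ℕ → ℕ) →
  ∑ (m * d) (λ k → χ (¬? (d ∣? k)) * h k) ≡ ∑ (m * d) h ∸ ∑ m (λ j → h (j * d))
∑-nonMultiples m d h = begin
  ∑ n N                          ≡⟨ sym (m+n∸m≡n (∑ n D) (∑ n N)) ⟩
  ∑ n D + ∑ n N ∸ ∑ n D          ≡⟨ cong₂ _∸_ (sym (∑-+ n D N)) (∑-multiples m d h) ⟩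
  ∑ n (λ k → D k + N k) ∸ ∑ m (λ j → h (j * d))  ≡⟨ cong (_∸ ∑ m (λ j → h (j * d))) (∑-cong n partition) ⟩
  ∑ n h ∸ ∑ m (λ j → h (j * d))  ∎
  where
  n : ℕ
  n = m * d
  D N : ℕ → ℕ
  D k = χ (d ∣? k) * h k
  N k = χ (¬? (d ∣? k)) * h k
  partition : ∀ k → D k + N k ≡ h k
  partition k = trans (sym (*-distribʳ-+ (h k) (χ (d ∣? k)) (χ (¬? (d ∣? k)))))
                      (trans (cong (_* h k) (χ-¬ (d ∣? k))) (*-identityˡ (h k)))

∑-select : ∀ n t (c : ℕ → ℕ) → ∑ n (λ e → χ (t ≟ e) * c e) ≡ χ (t <? n) * c t
∑-select zero    t       c = cong (_* c t) (sym (χ-no (λ ()) (t <? 0)))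
∑-select (suc n) zero    c = begin
  1 * c 0 + ∑ n (λ e → χ (0 ≟ suc e) * c (suc e))
    ≡⟨ cong (1 * c 0 +_) (∑-zero n (λ e _ → cong (_* c (suc e)) (χ-no (λ ()) (0 ≟ suc e)))) ⟩
  1 * c 0 + 0                      ≡⟨ +-identityʳ _ ⟩
  1 * c 0                          ≡⟨ cong (_* c 0) (sym (χ-yes (s≤s z≤n) (0 <? suc n))) ⟩
  χ (0 <? suc n) * c 0             ∎
∑-select (suc n) (suc t) c = begin
  χ (suc t ≟ 0) * c 0 + ∑ n (λ e → χ (suc t ≟ suc e) * c (suc e))
    ≡⟨ cong₂ _+_ (cong (_* c 0) (χ-no (λ ()) (suc t ≟ 0)))
                 (∑-cong n (λ e → cong (_* c (suc e)) (χ-cong suc-injective (cong suc) (suc t ≟ suc e) (t ≟ e)))) ⟩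
  ∑ n (λ e → χ (t ≟ e) * c (suc e))  ≡⟨ ∑-select n t (λ e → c (suc e)) ⟩
  χ (t <? n) * c (suc t)             ≡⟨ cong (_* c (suc t)) (χ-cong s≤s ≤-pred (t <? n) (suc t <? suc n)) ⟩
  χ (suc t <? suc n) * c (suc t)     ∎

sum-map-filter : ∀ {P : Pred ℕ 0ℓ} (P? : Decidable P) (g f : ℕ → ℕ) n →
  sum (map g (filter P? (applyUpTo f n))) ≡ ∑ n (λ k → χ (P? (f k)) * g (f k))
sum-map-filter P? g f zero = refl
sum-map-filter P? g f (suc n) with P? (f 0)
... | yes _ = cong₂ _+_ (sym (+-identityʳ (g (f 0)))) (sum-map-filter P? g (λ k → f (suc k)) n)
... | no _  = sum-map-filter P? g (λ k → f (suc k)) n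

length-filter : ∀ {P : Pred ℕ 0ℓ} (P? : Decidable P) (f : ℕ → ℕ) n →
  length (filter P? (applyUpTo f n)) ≡ ∑ n (λ k → χ (P? (f k)))
length-filter P? f zero = refl
length-filter P? f (suc n) with P? (f 0)
... | yes _ = cong suc (length-filter P? (λ k → f (suc k)) n)
... | no _  = length-filter P? (λ k → f (suc k)) n

-- The totient and the divisor sum as finite sums

gcd[n,n]≡n : ∀ n → gcd n n ≡ n
gcd[n,n]≡n n = ∣-antisym (gcd[m,n]∣m n n) (gcd-greatest ∣-refl ∣-refl)

-- φ n counts the residues k < n coprime to n (the residue 0 stands in for n).
φ-as-∑ : ∀ n → φ n ≡ ∑ n (λ k → χ (gcd k n ≟ 1))
φ-as-∑ n = begin
  length (filter (λ k → gcd k n ≟ 1) (map suc (upTo n)))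
    ≡⟨ cong (λ l → length (filter (λ k → gcd k n ≟ 1) l)) (map-upTo suc n) ⟩
  length (filter (λ k → gcd k n ≟ 1) (applyUpTo suc n))  ≡⟨ length-filter (λ k → gcd k n ≟ 1) suc n ⟩
  ∑ n (λ k → χ (gcd (suc k) n ≟ 1))                       ≡⟨ ∑-rotate n (λ k → χ (gcd k n ≟ 1)) gcd-n≡gcd-0 ⟩
  ∑ n (λ k → χ (gcd k n ≟ 1))                             ∎
  where
  gcd[n,n]≡gcd[0,n] : gcd n n ≡ gcd 0 n
  gcd[n,n]≡gcd[0,n] = trans (gcd[n,n]≡n n) (sym (gcd-identityˡ n))
  gcd-n≡gcd-0 : χ (gcd n n ≟ 1) ≡ χ (gcd 0 n ≟ 1)
  gcd-n≡gcd-0 = χ-cong (trans (sym gcd[n,n]≡gcd[0,n])) (trans gcd[n,n]≡gcd[0,n]) _ _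

gcd-*ʳ : ∀ j m d → gcd (j * d) (m * d) ≡ gcd j m * d
gcd-*ʳ j m d = begin
  gcd (j * d) (m * d)  ≡⟨ cong₂ gcd (*-comm j d) (*-comm m d) ⟩
  gcd (d * j) (d * m)  ≡⟨ sym (c*gcd[m,n]≡gcd[cm,cn] d j m) ⟩
  d * gcd j m          ≡⟨ *-comm d (gcd j m) ⟩
  gcd j m * d          ∎

-- For d ∣ x, φ (x / d) counts the residues k < x with gcd k x = d:
-- they are the k = j d with j < x / d and gcd j (x / d) = 1.
φ-quotient : ∀ x d .{{_ : NonZero d}} → d ∣ x → φ (x / d) ≡ ∑ x (λ k → χ (gcd k x ≟ d))
φ-quotient .(m * d) d (divides m refl) = begin
  φ (m * d / d)                              ≡⟨ cong φ (m*n/n≡m m d) ⟩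
  φ m                                        ≡⟨ φ-as-∑ m ⟩
  ∑ m (λ j → χ (gcd j m ≟ 1))               ≡⟨ ∑-cong m (λ j → χ-cong (scale j) (unscale j) _ _) ⟩
  ∑ m (λ j → χ (gcd (j * d) x ≟ d))          ≡⟨ sym (∑-multiples m d (λ k → χ (gcd k x ≟ d))) ⟩
  ∑ x (λ k → χ (d ∣? k) * χ (gcd k x ≟ d))  ≡⟨ ∑-cong x multiple-of-d ⟩
  ∑ x (λ k → χ (gcd k x ≟ d))               ∎
  where
  x : ℕ
  x = m * d
  scale : ∀ j → gcd j m ≡ 1 → gcd (j * d) x ≡ d
  scale j g≡1 = trans (gcd-*ʳ j m d) (trans (cong (_* d) g≡1) (*-identityˡ d))
  unscale : ∀ j → gcd (j * d) x ≡ d → gcd j m ≡ 1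
  unscale j g≡d = *-cancelʳ-≡ (gcd j m) 1 d (trans (sym (gcd-*ʳ j m d)) (trans g≡d (sym (*-identityˡ d))))
  -- gcd k x = d already forces d ∣ k
  multiple-of-d : ∀ k → χ (d ∣? k) * χ (gcd k x ≟ d) ≡ χ (gcd k x ≟ d)
  multiple-of-d k with gcd k x ≟ d
  ... | yes g≡d = cong (_* 1) (χ-yes (subst (_∣ k) g≡d (gcd[m,n]∣m k x)) (d ∣? k))
  ... | no _    = *-zeroʳ (χ (d ∣? k))

count : ℕ → ℕ → ℕ
count x y = ∑ x (λ k → χ (gcd k x ∣? y))

divisor-delta : ∀ y t .{{_ : NonZero y}} →
  ∑ y (λ e → χ (suc e ∣? y) * χ (suc t ≟ suc e)) ≡ χ (suc t ∣? y)
divisor-delta y t = begin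
  ∑ y (λ e → χ (suc e ∣? y) * χ (suc t ≟ suc e))  ≡⟨ ∑-cong y reindex ⟩
  ∑ y (λ e → χ (t ≟ e) * χ (suc e ∣? y))          ≡⟨ ∑-select y t (λ e → χ (suc e ∣? y)) ⟩
  χ (t <? y) * χ (suc t ∣? y)                     ≡⟨ in-range ⟩
  χ (suc t ∣? y)                                  ∎
  where
  reindex : ∀ e → χ (suc e ∣? y) * χ (suc t ≟ suc e) ≡ χ (t ≟ e) * χ (suc e ∣? y)
  reindex e = trans (*-comm (χ (suc e ∣? y)) _)
                    (cong (_* χ (suc e ∣? y)) (χ-cong suc-injective (cong suc) (suc t ≟ suc e) (t ≟ e)))
  in-range : χ (t <? y) * χ (suc t ∣? y) ≡ χ (suc t ∣? y)
  in-range with t <? y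
  ... | yes _   = +-identityʳ _
  ... | no t≮y = sym (χ-no (λ t+1∣y → t≮y (∣⇒≤ t+1∣y)) (suc t ∣? y))

-- Grouping the residues k < x by d = gcd k x turns the divisor sum into a count.
sumφQuot≡count : ∀ x y .{{_ : NonZero x}} → y ∣ x → sumφQuot x y ≡ count x y
sumφQuot≡count x y y∣x = begin
  sumφQuot x y
    ≡⟨ sum-map-filter (λ k → suc k ∣? y) (λ k → φ (x / suc k)) (λ k → k) y ⟩
  ∑ y (λ e → χ (suc e ∣? y) * φ (x / suc e))
    ≡⟨ ∑-cong y expand ⟩
  ∑ y (λ e → χ (suc e ∣? y) * ∑ x (λ k → χ (gcd k x ≟ suc e)))
    ≡⟨ ∑-cong y (λ e → ∑-*ˡ x (χ (suc e ∣? y)) _) ⟩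
  ∑ y (λ e → ∑ x (λ k → χ (suc e ∣? y) * χ (gcd k x ≟ suc e)))
    ≡⟨ ∑-swap y x _ ⟩
  ∑ x (λ k → ∑ y (λ e → χ (suc e ∣? y) * χ (gcd k x ≟ suc e)))
    ≡⟨ ∑-cong x collapse ⟩
  count x y ∎
  where
  expand : ∀ e → χ (suc e ∣? y) * φ (x / suc e) ≡ χ (suc e ∣? y) * ∑ x (λ k → χ (gcd k x ≟ suc e))
  expand e with suc e ∣? y
  ... | yes e+1∣y = cong (1 *_) (φ-quotient x (suc e) (∣-trans e+1∣y y∣x))
  ... | no _      = refl
  instance
    y≢0 : NonZero y
    y≢0 = ≢-nonZero (λ { refl → ≢-nonZero⁻¹ x (0∣⇒≡0 y∣x) })
  collapse : ∀ k → ∑ y (λ e → χ (suc e ∣? y) * χ (gcd k x ≟ suc e)) ≡ χ (gcd k x ∣? y)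
  collapse k with gcd k x in g≡
  ... | zero  = ⊥-elim (≢-nonZero⁻¹ x (gcd[m,n]≡0⇒n≡0 k g≡))
  ... | suc t = divisor-delta y t

-- Facts about gcd and coprimality

gcd-period : ∀ j X i → gcd (j * X + i) X ≡ gcd i X
gcd-period j X i = ∣-antisym
  (gcd-greatest (∣m+n∣m⇒∣n (gcd[m,n]∣m (j * X + i) X) (∣-trans (gcd[m,n]∣n (j * X + i) X) (n∣m*n j)))
                (gcd[m,n]∣n (j * X + i) X))
  (gcd-greatest (∣m∣n⇒∣m+n (∣-trans (gcd[m,n]∣n i X) (n∣m*n j)) (gcd[m,n]∣m i X))
                (gcd[m,n]∣n i X))

coprime-∣ : ∀ {d m n} → d ∣ m → Coprime m n → Coprime d n
coprime-∣ d∣m m⊥n (c∣d , c∣n) = m⊥n (∣-trans c∣d d∣m , c∣n)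

gcd-*-coprime : ∀ {q X} → Coprime q X → ∀ j → gcd (j * q) X ≡ gcd j X
gcd-*-coprime {q} {X} q⊥X j = ∣-antisym
  (gcd-greatest (coprime-divisor (coprime-∣ (gcd[m,n]∣n (j * q) X) (coprime-sym q⊥X))
                                 (subst (gcd (j * q) X ∣_) (*-comm j q) (gcd[m,n]∣m (j * q) X)))
                (gcd[m,n]∣n (j * q) X))
  (gcd-greatest (∣-trans (gcd[m,n]∣m j X) (m∣m*n q)) (gcd[m,n]∣n j X))

-- gcd is submultiplicative in its second argument:
-- gcd k m · gcd k n = gcd (c k) (c m) with c = gcd k n, and both are multiples of gcd k (m n).
gcd-∣-* : ∀ k m n → gcd k (m * n) ∣ gcd k m * gcd k n
gcd-∣-* k m n = subst (g ∣_) product≡ (gcd-greatest (∣-trans (gcd[m,n]∣m k (m * n)) (n∣m*n c)) g∣c*m)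
  where
  g c : ℕ
  g = gcd k (m * n)
  c = gcd k n
  g∣c*m : g ∣ c * m
  g∣c*m = subst (g ∣_) (trans (sym (c*gcd[m,n]≡gcd[cm,cn] m k n)) (*-comm m c))
            (gcd-greatest (∣-trans (gcd[m,n]∣m k (m * n)) (n∣m*n m)) (gcd[m,n]∣n k (m * n)))
  product≡ : gcd (c * k) (c * m) ≡ gcd k m * c
  product≡ = trans (sym (c*gcd[m,n]≡gcd[cm,cn] c k m)) (*-comm c (gcd k m))

χ-gcd-split : ∀ {M X M′ Y} k → Coprime M Y → Coprime M′ X →
  χ (gcd k (M * X) ∣? M′ * Y) ≡ χ (gcd k M ∣? M′) * χ (gcd k X ∣? Y)
χ-gcd-split {M} {X} {M′} {Y} k M⊥Y M′⊥X =
  trans (χ-cong split join (gcd k (M * X) ∣? M′ * Y) ((gcd k M ∣? M′) ×-dec (gcd k X ∣? Y)))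
        (χ-× (gcd k M ∣? M′) (gcd k X ∣? Y))
  where
  g : ℕ
  g = gcd k (M * X)
  gM∣g : gcd k M ∣ g
  gM∣g = gcd-greatest (gcd[m,n]∣m k M) (∣-trans (gcd[m,n]∣n k M) (m∣m*n X))
  gX∣g : gcd k X ∣ g
  gX∣g = gcd-greatest (gcd[m,n]∣m k X) (∣-trans (gcd[m,n]∣n k X) (n∣m*n M))
  split : g ∣ M′ * Y → gcd k M ∣ M′ × gcd k X ∣ Y
  split g∣M′Y =
    coprime-divisor (coprime-∣ (gcd[m,n]∣n k M) M⊥Y) (subst (gcd k M ∣_) (*-comm M′ Y) (∣-trans gM∣g g∣M′Y)) ,
    coprime-divisor (coprime-∣ (gcd[m,n]∣n k X) (coprime-sym M′⊥X)) (∣-trans gX∣g g∣M′Y)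
  join : gcd k M ∣ M′ × gcd k X ∣ Y → g ∣ M′ * Y
  join (gM∣M′ , gX∣Y) = ∣-trans (gcd-∣-* k M X) (*-pres-∣ gM∣M′ gX∣Y)

-- Prime powers

prime≢1 : ∀ {p} → Prime p → p ≢ 1
prime≢1 p-prime = nonTrivial⇒≢1 {{prime⇒nonTrivial p-prime}}

prime-coprime : ∀ {p n} → Prime p → ¬ p ∣ n → Coprime p n
prime-coprime p-prime p∤n (d∣p , d∣n) with prime⇒irreducible p-prime d∣p
... | inj₁ d≡1  = d≡1
... | inj₂ refl = ⊥-elim (p∤n d∣n)

^-monoʳ-∣ : ∀ p {m n} → m ≤ n → p ^ m ∣ p ^ n
^-monoʳ-∣ p {m} {n} m≤n = divides (p ^ (n ∸ m)) (begin
  p ^ n                ≡⟨ cong (p ^_) (sym (m+[n∸m]≡n m≤n)) ⟩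
  p ^ (m + (n ∸ m))    ≡⟨ ^-distribˡ-+-* p m (n ∸ m) ⟩
  p ^ m * p ^ (n ∸ m)  ≡⟨ *-comm (p ^ m) _ ⟩
  p ^ (n ∸ m) * p ^ m  ∎)

-- Every divisor of p ^ a is a power p ^ c with c ≤ a: peel off one factor p
-- when p divides the divisor, otherwise the divisor is coprime to p.
∣-prime-power : ∀ {p d} → Prime p → ∀ a → d ∣ p ^ a → ∃[ c ] (c ≤ a × d ≡ p ^ c)
∣-prime-power p-prime zero d∣1 = 0 , z≤n , ∣1⇒≡1 d∣1
∣-prime-power {p} {d} p-prime (suc a) d∣pᵃ⁺¹ with p ∣? d
... | yes (divides q refl) with ∣-prime-power p-prime a q∣pᵃ
  where
  instance
    p≢0 : NonZero p
    p≢0 = prime⇒nonZero p-prime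
  q∣pᵃ : q ∣ p ^ a
  q∣pᵃ = *-cancelʳ-∣ p (subst (q * p ∣_) (*-comm p (p ^ a)) d∣pᵃ⁺¹)
...   | c , c≤a , q≡pᶜ = suc c , s≤s c≤a , trans (cong (_* p) q≡pᶜ) (*-comm (p ^ c) p)
∣-prime-power {p} {d} p-prime (suc a) d∣pᵃ⁺¹ | no p∤d
  with ∣-prime-power p-prime a (coprime-divisor (coprime-sym (prime-coprime p-prime p∤d)) d∣pᵃ⁺¹)
... | c , c≤a , d≡pᶜ = c , m≤n⇒m≤1+n c≤a , d≡pᶜ

prime-power-coprime : ∀ {p n} → Prime p → ¬ p ∣ n → ∀ a → Coprime (p ^ a) n
prime-power-coprime {p} p-prime p∤n a (d∣pᵃ , d∣n) with ∣-prime-power p-prime a d∣pᵃ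
... | zero  , _ , d≡1    = d≡1
... | suc c , _ , refl   = ⊥-elim (p∤n (∣-trans (m∣m*n (p ^ c)) d∣n))

prime-∤-power : ∀ {p q} → Prime p → Prime q → q ≢ p → ∀ e → ¬ p ∣ q ^ e
prime-∤-power {p} {q} p-prime q-prime q≢p e p∣qᵉ with ∣-prime-power q-prime e p∣qᵉ
... | zero  , _ , p≡1 = prime≢1 p-prime p≡1
... | suc c , _ , p≡qᶜ⁺¹ with prime⇒irreducible p-prime (subst (q ∣_) (sym p≡qᶜ⁺¹) (m∣m*n (q ^ c)))
...   | inj₁ q≡1 = prime≢1 q-prime q≡1
...   | inj₂ q≡p = q≢p q≡p

χ-gcd-prime-power : ∀ {p a b} → Prime p → b < a → ∀ k →
  χ (gcd k (p ^ a) ∣? p ^ b) ≡ χ (¬? (p ^ suc b ∣? k))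
χ-gcd-prime-power {p} {a} {b} p-prime b<a k = χ-cong small large _ _
  where
  instance
    pᵇ≢0 : NonZero (p ^ b)
    pᵇ≢0 = m^n≢0 p b {{prime⇒nonZero p-prime}}
  pᵇ⁺¹∤pᵇ : ¬ p ^ suc b ∣ p ^ b
  pᵇ⁺¹∤pᵇ pᵇ⁺¹∣pᵇ = prime≢1 p-prime (∣1⇒≡1 (*-cancelʳ-∣ (p ^ b)
    (subst (p * p ^ b ∣_) (sym (*-identityˡ (p ^ b))) pᵇ⁺¹∣pᵇ)))
  small : gcd k (p ^ a) ∣ p ^ b → ¬ p ^ suc b ∣ k
  small g∣pᵇ pᵇ⁺¹∣k = pᵇ⁺¹∤pᵇ (∣-trans (gcd-greatest pᵇ⁺¹∣k (^-monoʳ-∣ p b<a)) g∣pᵇ)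
  large : ¬ p ^ suc b ∣ k → gcd k (p ^ a) ∣ p ^ b
  large pᵇ⁺¹∤k with ∣-prime-power p-prime a (gcd[m,n]∣n k (p ^ a))
  ... | c , _ , g≡pᶜ with c ≤? b
  ...   | yes c≤b = subst (_∣ p ^ b) (sym g≡pᶜ) (^-monoʳ-∣ p c≤b)
  ...   | no c≰b  = ⊥-elim (pᵇ⁺¹∤k (∣-trans (^-monoʳ-∣ p (≰⇒> c≰b))
                                            (subst (_∣ k) g≡pᶜ (gcd[m,n]∣m k (p ^ a)))))

-- The count is multiplicative over the primes

count-periodic : ∀ m X Y → ∑ (m * X) (λ k → χ (gcd k X ∣? Y)) ≡ m * count X Y
count-periodic m X Y = ∑-periodic m X (λ k → χ (gcd k X ∣? Y)) (λ j i →
  χ-cong (subst (_∣ Y) (gcd-period j X i)) (subst (_∣ Y) (sym (gcd-period j X i))) _ _)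

localFactor : ℕ → ℕ → ℕ → ℕ
localFactor p a b = (if ⌊ a ≟ b ⌋ then p ^ a else 1) * (if ⌊ b <? a ⌋ then p ^ a ∸ p ^ (a ∸ b ∸ 1) else 1)

localFactor-equal : ∀ p a → localFactor p a a ≡ p ^ a
localFactor-equal p a with a ≟ a | a <? a
... | yes _   | no _    = *-identityʳ (p ^ a)
... | no a≢a  | _       = ⊥-elim (a≢a refl)
... | yes _   | yes a<a = ⊥-elim (n≮n a a<a)

localFactor-less : ∀ p a b → b < a → localFactor p a b ≡ p ^ a ∸ p ^ (a ∸ suc b)
localFactor-less p a b b<a with a ≟ b | b <? a
... | no _     | yes _   = trans (*-identityˡ _) (cong (λ e → p ^ a ∸ p ^ e) a∸b∸1≡a∸[1+b])
  where
  a∸b∸1≡a∸[1+b] : a ∸ b ∸ 1 ≡ a ∸ suc b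
  a∸b∸1≡a∸[1+b] = trans (∸-+-assoc a b 1) (cong (a ∸_) (+-comm b 1))
... | yes refl | _       = ⊥-elim (n≮n b b<a)
... | no _     | no b≮a  = ⊥-elim (b≮a b<a)

module _ {p X Y : ℕ} (p-prime : Prime p) (p∤X : ¬ p ∣ X) (p∤Y : ¬ p ∣ Y) where

  instance
    p≢0 : NonZero p
    p≢0 = prime⇒nonZero p-prime

  P : ℕ → ℕ
  P k = χ (gcd k X ∣? Y)

  count-split : ∀ a b → count (p ^ a * X) (p ^ b * Y) ≡ ∑ (p ^ a * X) (λ k → χ (gcd k (p ^ a) ∣? p ^ b) * P k)
  count-split a b = ∑-cong (p ^ a * X) (λ k →
    χ-gcd-split k (prime-power-coprime p-prime p∤Y a) (prime-power-coprime p-prime p∤X b))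

  -- b = a: the p-part of the test always succeeds.
  count-equal : ∀ a → count (p ^ a * X) (p ^ a * Y) ≡ p ^ a * count X Y
  count-equal a = begin
    count (p ^ a * X) (p ^ a * Y)                            ≡⟨ count-split a a ⟩
    ∑ (p ^ a * X) (λ k → χ (gcd k (p ^ a) ∣? p ^ a) * P k)  ≡⟨ ∑-cong (p ^ a * X) (λ k →
                                                                 cong (_* P k) (χ-yes (gcd[m,n]∣n k (p ^ a)) (gcd k (p ^ a) ∣? p ^ a))) ⟩
    ∑ (p ^ a * X) (λ k → 1 * P k)                            ≡⟨ ∑-cong (p ^ a * X) (λ k → *-identityˡ (P k)) ⟩
    ∑ (p ^ a * X) P                                          ≡⟨ count-periodic (p ^ a) X Y ⟩
    p ^ a * count X Y                                        ∎

  -- b < a: the p-part fails exactly on the multiples of q = p^(b+1); those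
  -- residues are the j q with j < p^e X (e = a − b − 1), and P (j q) = P j.
  count-less : ∀ a b → b < a → count (p ^ a * X) (p ^ b * Y) ≡ (p ^ a ∸ p ^ (a ∸ suc b)) * count X Y
  count-less a b b<a = begin
    count x (p ^ b * Y)                                ≡⟨ count-split a b ⟩
    ∑ x (λ k → χ (gcd k (p ^ a) ∣? p ^ b) * P k)
      ≡⟨ ∑-cong x (λ k → cong (_* P k) (χ-gcd-prime-power p-prime b<a k)) ⟩
    ∑ x (λ k → χ (¬? (q ∣? k)) * P k)
      ≡⟨ cong (λ n → ∑ n (λ k → χ (¬? (q ∣? k)) * P k)) x≡m*q ⟩
    ∑ (m * q) (λ k → χ (¬? (q ∣? k)) * P k)            ≡⟨ ∑-nonMultiples m q P ⟩
    ∑ (m * q) P ∸ ∑ m (λ j → P (j * q))                ≡⟨ cong₂ _∸_ (cong (λ n → ∑ n P) (sym x≡m*q))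
                                                            (∑-cong m (λ j → cong (λ g → χ (g ∣? Y)) (gcd-*-coprime q⊥X j))) ⟩
    ∑ x P ∸ ∑ m P
      ≡⟨ cong₂ _∸_ (count-periodic (p ^ a) X Y) (count-periodic (p ^ e) X Y) ⟩
    p ^ a * count X Y ∸ p ^ e * count X Y              ≡⟨ sym (*-distribʳ-∸ (count X Y) (p ^ a) (p ^ e)) ⟩
    (p ^ a ∸ p ^ e) * count X Y                        ∎
    where
    x q e m : ℕ
    x = p ^ a * X
    q = p ^ suc b
    e = a ∸ suc b
    m = p ^ e * X
    instance
      q≢0 : NonZero q
      q≢0 = m^n≢0 p (suc b)
    q⊥X : Coprime q X
    q⊥X = prime-power-coprime p-prime p∤X (suc b)
    x≡m*q : x ≡ m * q
    x≡m*q = begin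
      p ^ a * X              ≡⟨ cong (λ n → p ^ n * X) (sym (m+[n∸m]≡n b<a)) ⟩
      p ^ (suc b + e) * X    ≡⟨ cong (_* X) (^-distribˡ-+-* p (suc b) e) ⟩
      q * p ^ e * X          ≡⟨ cong (_* X) (*-comm q (p ^ e)) ⟩
      p ^ e * q * X          ≡⟨ *-assoc (p ^ e) q X ⟩
      p ^ e * (q * X)        ≡⟨ cong (p ^ e *_) (*-comm q X) ⟩
      p ^ e * (X * q)        ≡⟨ sym (*-assoc (p ^ e) X q) ⟩
      m * q                  ∎

  count-step : ∀ a b → b ≤ a → count (p ^ a * X) (p ^ b * Y) ≡ localFactor p a b * count X Y
  count-step a b b≤a with m≤n⇒m<n∨m≡n b≤a
  ... | inj₁ b<a  = trans (count-less a b b<a) (cong (_* count X Y) (sym (localFactor-less p a b b<a)))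
  ... | inj₂ refl = trans (count-equal a) (cong (_* count X Y) (sym (localFactor-equal p a)))

-- Finite products

∏-* : ∀ r (f g : Fin r → ℕ) → ∏ r (λ i → f i * g i) ≡ ∏ r f * ∏ r g
∏-* zero    f g = refl
∏-* (suc r) f g = trans (cong (f fzero * g fzero *_) (∏-* r (λ i → f (fsuc i)) (λ i → g (fsuc i))))
                        (*-interchange (f fzero) (g fzero) _ _)

∏-∣ : ∀ r (f g : Fin r → ℕ) → (∀ i → f i ∣ g i) → ∏ r f ∣ ∏ r g
∏-∣ zero    f g f∣g = ∣-refl
∏-∣ (suc r) f g f∣g = *-pres-∣ (f∣g fzero) (∏-∣ r (λ i → f (fsuc i)) (λ i → g (fsuc i)) (λ i → f∣g (fsuc i)))

∏-nonZero : ∀ r (f : Fin r → ℕ) → (∀ i → NonZero (f i)) → NonZero (∏ r f)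
∏-nonZero zero    f f≢0 = _
∏-nonZero (suc r) f f≢0 = m*n≢0 (f fzero) _ {{f≢0 fzero}} {{∏-nonZero r (λ i → f (fsuc i)) (λ i → f≢0 (fsuc i))}}

prime-∤-∏ : ∀ {p} → Prime p → ∀ r (q e : Fin r → ℕ) → (∀ i → Prime (q i)) → (∀ i → q i ≢ p) →
  ¬ p ∣ ∏ r (λ i → q i ^ e i)
prime-∤-∏ p-prime zero    q e q-prime q≢p p∣1 = prime≢1 p-prime (∣1⇒≡1 p∣1)
prime-∤-∏ p-prime (suc r) q e q-prime q≢p p∣∏ with euclidsLemma _ _ p-prime p∣∏
... | inj₁ p∣q₀ = prime-∤-power p-prime (q-prime fzero) (q≢p fzero) (e fzero) p∣q₀
... | inj₂ p∣∏′ = prime-∤-∏ p-prime r (λ i → q (fsuc i)) (λ i → e (fsuc i))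
                    (λ i → q-prime (fsuc i)) (λ i → q≢p (fsuc i)) p∣∏′

count-∏ : ∀ r (p α β : Fin r → ℕ) → Injective _≡_ _≡_ p → (∀ i → Prime (p i)) → (∀ i → β i ≤ α i) →
  count (∏ r (λ i → p i ^ α i)) (∏ r (λ i → p i ^ β i)) ≡ ∏ r (λ i → localFactor (p i) (α i) (β i))
count-∏ zero    p α β p-inj p-prime β≤α = refl
count-∏ (suc r) p α β p-inj p-prime β≤α =
  trans (count-step (p-prime fzero) (p₀∤ α′) (p₀∤ β′) (α fzero) (β fzero) (β≤α fzero))
        (cong (localFactor (p fzero) (α fzero) (β fzero) *_)
              (count-∏ r p′ α′ β′ (λ eq → fsuc-injective (p-inj eq)) (λ i → p-prime (fsuc i)) (λ i → β≤α (fsuc i))))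
  where
  p′ α′ β′ : Fin r → ℕ
  p′ i = p (fsuc i)
  α′ i = α (fsuc i)
  β′ i = β (fsuc i)
  p₀∤ : ∀ (e : Fin r → ℕ) → ¬ p fzero ∣ ∏ r (λ i → p′ i ^ e i)
  p₀∤ e = prime-∤-∏ (p-prime fzero) r p′ e (λ i → p-prime (fsuc i)) (λ i eq → fzero≢fsuc (sym (p-inj eq)))

lemma2p5 : (r : ℕ) (p α β : Fin r → ℕ) →
    Injective _≡_ _≡_ p →
    (∀ i → Prime (p i)) →
    (∀ i → 1 ≤ α i) →
    (∀ i → β i ≤ α i) →
    sumφQuot (∏ r (λ i → p i ^ α i)) (∏ r (λ i → p i ^ β i))
    ≡ ∏ r (λ i → if ⌊ α i ≟ β i ⌋ then p i ^ α i else 1)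
    * ∏ r (λ i → if ⌊ β i <? α i ⌋ then p i ^ α i ∸ p i ^ (α i ∸ β i ∸ 1) else 1)
lemma2p5 r p α β p-inj p-prime _ β≤α = begin
  sumφQuot x y                                ≡⟨ sumφQuot≡count x y {{x≢0}} y∣x ⟩
  count x y                                   ≡⟨ count-∏ r p α β p-inj p-prime β≤α ⟩
  ∏ r (λ i → localFactor (p i) (α i) (β i))   ≡⟨ ∏-* r equalPart lessPart ⟩
  ∏ r equalPart * ∏ r lessPart                ∎
  where
  x y : ℕ
  x = ∏ r (λ i → p i ^ α i)
  y = ∏ r (λ i → p i ^ β i)
  equalPart lessPart : Fin r → ℕ
  equalPart i = if ⌊ α i ≟ β i ⌋ then p i ^ α i else 1
  lessPart  i = if ⌊ β i <? α i ⌋ then p i ^ α i ∸ p i ^ (α i ∸ β i ∸ 1) else 1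
  x≢0 : NonZero x
  x≢0 = ∏-nonZero r (λ i → p i ^ α i) (λ i → m^n≢0 (p i) (α i) {{prime⇒nonZero (p-prime i)}})
  y∣x : y ∣ x
  y∣x = ∏-∣ r (λ i → p i ^ β i) (λ i → p i ^ α i) (λ i → ^-monoʳ-∣ (p i) (β≤α i))
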